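{- Let $\mathfrak{M}=(M,\oplus,\preceq)$ be a partially ordered commutative semigroup. Then (1) for every $a\in M$ there exists a unique block $\mathcal B(a)$ of $\mathfrak M$ containing $a$; and (2) for $a,b\in M$, $a$ and $b$ lie in the same block if and only if there exist positive integers $m,n$ such that $m\times a\succeq b$ and $n\times b\succeq a$.
   Context: A partially ordered commutative semigroup is a triple $\mathfrak M=(M,\oplus,\preceq)$ where $(M,\oplus)$ is a commutative semigroup, $\preceq$ is a reflexive partial order on $M$, $a\preceq a\oplus b$ for all $a,b$, and $b\preceq c$ implies $a\oplus b\preceq a\oplus c$. For a positive integer $n$, $n\times a=a\oplus\dots\oplus a$ ($n$ times). A partially ordered commutative semigroup is archimedean if for all $a,b$ there is $n$ with $n\times a\succeq b$. A block of $\mathfrak M$ is either a subset of $M$ which induces a maximal archimedean subsemigroup of $\mathfrak M$ (a subset closed under $\oplus$ with the induced operation and order), or a special block $\mathbf 0$ corresponding to the empty set. -}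

module Defs where

open import Level using (0ℓ)
open import Data.Nat using (ℕ; zero; suc; NonZero)
open import Data.Product using (Σ; ∃-syntax; _×_)
open import Data.Empty using (⊥)
open import Relation.Binary.PropositionalEquality using (_≡_)
open import Relation.Binary.Structures using (IsPartialOrder)
open import Algebra.Structures using (IsCommutativeSemigroup)

record POCSemigroup : Set₁ where
  field
    Carrier : Set
    _⊕_     : Carrier → Carrier → Carrier
    _≼_     : Carrier → Carrier → Set
    isCommutativeSemigroup : IsCommutativeSemigroup _≡_ _⊕_
    isPartialOrder         : IsPartialOrder _≡_ _≼_
    ≼-⊕    : ∀ a b → a ≼ (a ⊕ b)
    ⊕-mono : ∀ a {b c} → b ≼ c → (a ⊕ b) ≼ (a ⊕ c)

module _ (𝔐 : POCSemigroup) where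
  open POCSemigroup 𝔐

  times : (n : ℕ) → .{{NonZero n}} → Carrier → Carrier
  times (suc zero)    a = a
  times (suc (suc n)) a = a ⊕ times (suc n) a

  Subset : Set₁
  Subset = Carrier → Set

  _⊆_ : Subset → Subset → Set
  S ⊆ T = ∀ a → S a → T a

  Closed : Subset → Set
  Closed S = ∀ a b → S a → S b → S (a ⊕ b)

  Archimedean : Subset → Set
  Archimedean S = ∀ a b → S a → S b →
    ∃[ n ] Σ (NonZero n) λ nz → b ≼ times n {{nz}} a

  IsArchSub : Subset → Set
  IsArchSub S = Closed S × Archimedean S

  IsMaxArchSub : Subset → Set₁
  IsMaxArchSub S = IsArchSub S × (∀ (T : Subset) → IsArchSub T → S ⊆ T → T ⊆ S)

  data Block : Set₁ where
    𝟎   : Block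
    blk : (S : Subset) → IsMaxArchSub S → Block

  _∈B_ : Carrier → Block → Set
  a ∈B 𝟎         = ⊥
  a ∈B blk S _   = S a

  _≐_ : Block → Block → Set
  B₁ ≐ B₂ = ∀ x → (x ∈B B₁ → x ∈B B₂) × (x ∈B B₂ → x ∈B B₁)

  SameBlock : Carrier → Carrier → Set₁
  SameBlock a b = Σ Block λ B → a ∈B B × b ∈B B

module Submission where

-- Say that x is dominated by a, written x ≲ a, when x ≼ n × a for some
-- positive n.  Using monotonicity of ⊕ and the laws n × a ⊕ m × a = (n+m) × a,
-- m × (n × a) = (mn) × a, domination is a preorder, it is preserved by sums
-- of dominated elements, and a ≲ a ⊕ x.  The archimedean class of a is
--   [ a ] = { x | x ≲ a and a ≲ x }.
-- It contains a, is closed under ⊕ and is archimedean (by transitivity of ≲).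
-- Conversely any two elements of an archimedean subsemigroup dominate each
-- other, so every archimedean subsemigroup containing a lies inside [ a ].
-- Hence [ a ] is a maximal archimedean subsemigroup, i.e. a block, and every
-- block containing a coincides with it: this is part (1).  Part (2) follows
-- because a and b share a block exactly when b ∈ [ a ].

open import Defs
open import Data.Nat using (ℕ; zero; suc; _+_; _*_; NonZero)
open import Data.Nat.Properties using (+-identityʳ; +-suc)
open import Data.Product using (Σ; ∃-syntax; _×_; _,_)
open import Data.Empty using (⊥-elim)
open import Function.Bundles using (_⇔_; mk⇔; Equivalence)
open import Relation.Binary.PropositionalEquality
  using (_≡_; refl; sym; cong; subst; subst₂; module ≡-Reasoning)
open import Algebra.Structures using (IsCommutativeSemigroup)
open import Relation.Binary.Structures using (IsPartialOrder)

module Blocks (𝔐 : POCSemigroup) where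
  open POCSemigroup 𝔐
  open IsCommutativeSemigroup isCommutativeSemigroup using (assoc; comm)
  open IsPartialOrder isPartialOrder
    using () renaming (refl to ≼-refl; trans to ≼-trans)

  -- Multiples indexed from zero: k ×⁺ a = (k+1) × a.  This avoids carrying
  -- NonZero proofs through the arithmetic below.
  infixr 25 _×⁺_
  _×⁺_ : ℕ → Carrier → Carrier
  zero  ×⁺ a = a
  suc k ×⁺ a = a ⊕ (k ×⁺ a)

  ×⁺≡times : ∀ k a → k ×⁺ a ≡ times 𝔐 (suc k) a
  ×⁺≡times zero    a = refl
  ×⁺≡times (suc k) a = cong (a ⊕_) (×⁺≡times k a)

  -- ⊕ is monotone in both arguments (the axiom only gives the right one).
  ⊕-mono₂ : ∀ {a b c d} → a ≼ b → c ≼ d → (a ⊕ c) ≼ (b ⊕ d)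
  ⊕-mono₂ {a} {b} {c} {d} a≼b c≼d =
    ≼-trans (⊕-mono a c≼d) (subst₂ _≼_ (comm d a) (comm d b) (⊕-mono d a≼b))

  ×⁺-mono : ∀ k {x y} → x ≼ y → (k ×⁺ x) ≼ (k ×⁺ y)
  ×⁺-mono zero    x≼y = x≼y
  ×⁺-mono (suc k) x≼y = ⊕-mono₂ x≼y (×⁺-mono k x≼y)

  ×⁺-+ : ∀ p q a → (p ×⁺ a) ⊕ (q ×⁺ a) ≡ suc (p + q) ×⁺ a
  ×⁺-+ zero    q a = refl
  ×⁺-+ (suc p) q a = begin
    (a ⊕ p ×⁺ a) ⊕ q ×⁺ a   ≡⟨ assoc a (p ×⁺ a) (q ×⁺ a) ⟩
    a ⊕ (p ×⁺ a ⊕ q ×⁺ a)   ≡⟨ cong (a ⊕_) (×⁺-+ p q a) ⟩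
    a ⊕ suc (p + q) ×⁺ a    ∎
    where open ≡-Reasoning

  ×⁺-* : ∀ q n x → q ×⁺ (n ×⁺ x) ≡ (n + q * suc n) ×⁺ x
  ×⁺-* zero    n x = cong (_×⁺ x) (sym (+-identityʳ n))
  ×⁺-* (suc q) n x = begin
    n ×⁺ x ⊕ q ×⁺ (n ×⁺ x)          ≡⟨ cong (n ×⁺ x ⊕_) (×⁺-* q n x) ⟩
    n ×⁺ x ⊕ (n + q * suc n) ×⁺ x   ≡⟨ ×⁺-+ n (n + q * suc n) x ⟩
    suc (n + (n + q * suc n)) ×⁺ x  ≡⟨ cong (_×⁺ x) (sym (+-suc n (n + q * suc n))) ⟩
    (n + suc (n + q * suc n)) ×⁺ x  ∎
    where open ≡-Reasoning

  infix 4 _≲_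
  _≲_ : Carrier → Carrier → Set
  x ≲ a = ∃[ k ] x ≼ (k ×⁺ a)

  ≲⇔times : ∀ x a → x ≲ a ⇔ (∃[ n ] Σ (NonZero n) λ nz → x ≼ times 𝔐 n {{nz}} a)
  ≲⇔times x a = mk⇔ to from
    where
    to : x ≲ a → ∃[ n ] Σ (NonZero n) λ nz → x ≼ times 𝔐 n {{nz}} a
    to (k , x≼) = suc k , _ , subst (x ≼_) (×⁺≡times k a) x≼
    from : (∃[ n ] Σ (NonZero n) λ nz → x ≼ times 𝔐 n {{nz}} a) → x ≲ a
    from (zero  , nz , _)  = ⊥-elim (NonZero.nonZero nz)
    from (suc k , _  , x≼) = k , subst (x ≼_) (sym (×⁺≡times k a)) x≼

  ≲-refl : ∀ {a} → a ≲ a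
  ≲-refl = 0 , ≼-refl

  ≲-trans : ∀ {x y z} → x ≲ y → y ≲ z → x ≲ z
  ≲-trans {x} {y} {z} (p , x≼) (q , y≼) =
    q + p * suc q , subst (x ≼_) (×⁺-* p q z) (≼-trans x≼ (×⁺-mono p y≼))

  ≲-⊕ : ∀ {x y a} → x ≲ a → y ≲ a → (x ⊕ y) ≲ a
  ≲-⊕ {x} {y} {a} (p , x≼) (q , y≼) =
    suc (p + q) , subst ((x ⊕ y) ≼_) (×⁺-+ p q a) (⊕-mono₂ x≼ y≼)

  ≲-⊕ʳ : ∀ {a x} y → a ≲ x → a ≲ (x ⊕ y)
  ≲-⊕ʳ {x = x} y (q , a≼) = q , ≼-trans a≼ (×⁺-mono q (≼-⊕ x y))

  archimedean⇒≲ : ∀ {S} → Archimedean 𝔐 S → ∀ {a x} → S a → S x → x ≲ a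
  archimedean⇒≲ arch {a} {x} sa sx =
    Equivalence.from (≲⇔times x a) (arch a x sa sx)

  [_] : Carrier → Subset 𝔐
  [ a ] x = x ≲ a × a ≲ x

  ∈[self] : ∀ a → [ a ] a
  ∈[self] a = ≲-refl , ≲-refl

  [a]-closed : ∀ a → Closed 𝔐 [ a ]
  [a]-closed a x y (x≲a , a≲x) (y≲a , _) = ≲-⊕ x≲a y≲a , ≲-⊕ʳ y a≲x

  [a]-archimedean : ∀ a → Archimedean 𝔐 [ a ]
  [a]-archimedean a x y (_ , a≲x) (y≲a , _) =
    Equivalence.to (≲⇔times y x) (≲-trans y≲a a≲x)

  [a]-arch : ∀ a → IsArchSub 𝔐 [ a ]
  [a]-arch a = [a]-closed a , [a]-archimedean a

  ⊆[a] : ∀ {S a} → IsArchSub 𝔐 S → S a → _⊆_ 𝔐 S [ a ]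
  ⊆[a] (_ , arch) sa x sx = archimedean⇒≲ arch sa sx , archimedean⇒≲ arch sx sa

  [a]-maximal : ∀ a → IsMaxArchSub 𝔐 [ a ]
  [a]-maximal a = [a]-arch a , λ T archT [a]⊆T → ⊆[a] archT ([a]⊆T a (∈[self] a))

  𝓑 : Carrier → Block 𝔐
  𝓑 a = blk [ a ] ([a]-maximal a)

  -- A block containing a is [ a ]: it is inside [ a ] by ⊆[a], and contains
  -- [ a ] by its own maximality.
  𝓑-unique : ∀ a (B : Block 𝔐) → _∈B_ 𝔐 a B → _≐_ 𝔐 B (𝓑 a)
  𝓑-unique a 𝟎 ()
  𝓑-unique a (blk S (archS , maxS)) sa x =
    ⊆[a] archS sa x , maxS [ a ] ([a]-arch a) (⊆[a] archS sa) x

  sameBlock⇔∼ : ∀ a b → SameBlock 𝔐 a b ⇔ (b ≲ a × a ≲ b)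
  sameBlock⇔∼ a b = mk⇔ to (λ b∈[a] → 𝓑 a , ∈[self] a , b∈[a])
    where
    to : SameBlock 𝔐 a b → b ≲ a × a ≲ b
    to (𝟎 , () , _)
    to (blk S ((_ , arch) , _) , sa , sb) =
      archimedean⇒≲ arch sa sb , archimedean⇒≲ arch sb sa

lemma4p6 : (𝔐 : POCSemigroup) → let open POCSemigroup 𝔐 in
    (∀ (a : Carrier) →
       Σ (Block 𝔐) (λ B → _∈B_ 𝔐 a B
         × (∀ (B' : Block 𝔐) → _∈B_ 𝔐 a B' → _≐_ 𝔐 B' B)))
    × (∀ (a b : Carrier) →
       (SameBlock 𝔐 a b ⇔
         (∃[ m ] ∃[ n ] Σ (NonZero m) λ nzm → Σ (NonZero n) λ nzn →
            (b ≼ times 𝔐 m {{nzm}} a) × (a ≼ times 𝔐 n {{nzn}} b))))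
lemma4p6 𝔐 = (λ a → 𝓑 a , ∈[self] a , 𝓑-unique a) , part2
  where
  open POCSemigroup 𝔐
  open Blocks 𝔐

  part2 : ∀ a b → SameBlock 𝔐 a b ⇔
    (∃[ m ] ∃[ n ] Σ (NonZero m) λ nzm → Σ (NonZero n) λ nzn →
       (b ≼ times 𝔐 m {{nzm}} a) × (a ≼ times 𝔐 n {{nzn}} b))
  part2 a b = mk⇔
    (λ same → let (b≲a , a≲b)    = Equivalence.to (sameBlock⇔∼ a b) same
                  (m , nzm , b≼) = Equivalence.to (≲⇔times b a) b≲a
                  (n , nzn , a≼) = Equivalence.to (≲⇔times a b) a≲b
              in m , n , nzm , nzn , b≼ , a≼)
    (λ (m , n , nzm , nzn , b≼ , a≼) → Equivalence.from (sameBlock⇔∼ a b)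
       (Equivalence.from (≲⇔times b a) (m , nzm , b≼) , Equivalence.from (≲⇔times a b) (n , nzn , a≼)))
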